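{- Let $m\le n$ and let $\sigma$ satisfy $\sqrt{\sigma}\le\min(m,n/2)$. For $m\times n$ arrays with entries from the alphabet $\{0,\dots,\sigma\}$ of size $\sigma+1$, at least $\Omega(mn\log\sigma)$ bits are necessary to answer 4-sided RMQ.
   Context: For a rectangle $[i_1,i_2]\times[j_1,j_2]$, $\mathsf{rmq}(i_1,i_2,j_1,j_2)$ returns the position of a smallest element in the rectangle, ties broken by returning the top-leftmost such position. A 4-sided RMQ is a query with an arbitrary rectangular range $[i_1,i_2]\times[j_1,j_2]$, $1\le i_1\le i_2\le m$, $1\le j_1\le j_2\le n$. "At least $X$ bits are necessary" means that the number of distinct answer functions (query $\mapsto$ answer) induced by all admissible input arrays is at least $2^X$. -}

module Defs where

open import Data.Nat using (ℕ; suc; _<ᵇ_)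
open import Data.Fin using (Fin; toℕ; _≤?_)
open import Data.Fin.Base using () renaming (_≤_ to _≤ᶠ_)
open import Data.Bool using (if_then_else_)
open import Data.List using (List; allFin; filter; foldl; concatMap; map)
open import Data.Product using (_×_; _,_; proj₁; proj₂)
open import Relation.Nullary using (Dec; yes; no)
open import Relation.Nullary.Decidable using (_×-dec_)
open import Relation.Binary.PropositionalEquality using (_≡_)

Array : ℕ → ℕ → ℕ → Set
Array m n σ = Fin m → Fin n → Fin (suc σ)

Pos : ℕ → ℕ → Set
Pos m n = Fin m × Fin n

rect : ∀ {m n} → Fin m → Fin m → Fin n → Fin n → List (Pos m n)
rect {m} {n} i₁ i₂ j₁ j₂ =
  concatMap (λ i → map (λ j → (i , j))
                       (filter (λ j → (j₁ ≤? j) ×-dec (j ≤? j₂)) (allFin n)))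
            (filter (λ i → (i₁ ≤? i) ×-dec (i ≤? i₂)) (allFin m))

-- rmq(i₁,i₂,j₁,j₂): position of a smallest entry of the rectangle; ties are
-- broken towards the top-leftmost position (smallest row, then smallest
-- column): scanning in row-major order, we only replace the current best on
-- a strictly smaller value.  The start value (i₁,j₁) is the first position
-- of the (nonempty, when i₁ ≤ i₂ and j₁ ≤ j₂) rectangle in row-major order.
rmq : ∀ {m n σ} → Array m n σ → Fin m → Fin m → Fin n → Fin n → Pos m n
rmq A i₁ i₂ j₁ j₂ =
  foldl (λ best p → if toℕ (A (proj₁ p) (proj₂ p)) <ᵇ toℕ (A (proj₁ best) (proj₂ best))
                     then p else best)
        (i₁ , j₁) (rect i₁ i₂ j₁ j₂)

SameAnswers : ∀ {m n σ} → Array m n σ → Array m n σ → Set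
SameAnswers {m} {n} A B =
  (i₁ i₂ : Fin m) (j₁ j₂ : Fin n) → i₁ ≤ᶠ i₂ → j₁ ≤ᶠ j₂ →
  rmq A i₁ i₂ j₁ j₂ ≡ rmq B i₁ i₂ j₁ j₂

-- "At least X bits are necessary": there are at least 2^X distinct answer
-- functions, i.e. a family of K ≥ 2^X arrays with pairwise distinct
-- answer functions.
record DistinctFamily (m n σ : ℕ) : Set where
  field
    K      : ℕ
    arrays : Fin K → Array m n σ
    distinct : ∀ k l → SameAnswers (arrays k) (arrays l) → k ≡ l

-- Tile the array with blocks of (3d+2) × (2d+2) cells, where d + 1 = 2^h is of order √σ. A block
-- carries a (d+1) × (d+1) square of free digits y ∈ [0, d+1], stored as the even values
-- 2(ℓ(d+2) + y) where ℓ = 2d − (i+j) is the level of cell (i, j), next to (2d+1) × (d+1)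
-- reference cells holding the odd values 2(α(d+2) + β) + 1; all other cells hold σ. If two arrays
-- give digits x < x′ to the same data cell, the rectangle spanned by the reference cell (ℓ, x) and
-- that data cell has its unique minimum at the data cell in the first array and at the reference
-- cell in the second. Hence all (d+2)^N digit assignments have distinct answer functions, where
-- N ≥ mn/24 is the number of data cells and d + 2 ≥ 2^(⌊log₂ σ⌋/7).

module Submission where

open import Defs
open import Data.Nat
  using ( ℕ; zero; suc; pred; _+_; _*_; _∸_; _^_; _<_; _≤_; _<ᵇ_; _<?_; ⌊_/2⌋
        ; z≤n; s≤s; s<s; s≤s⁻¹; NonZero)
open import Data.Nat.Properties
open import Data.Fin using (Fin; toℕ; fromℕ<; combine) renaming (_≤_ to _≤ᶠ_; _≤?_ to _≤ᶠ?_)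
open import Data.Fin.Properties
  using (toℕ<n; toℕ-fromℕ<; toℕ-injective; combine-surjective; toℕ-combine)
open import Data.Nat.DivMod
open import Data.Nat.Divisibility using (n∣m*n)
open import Data.Nat.Logarithm using (⌊log₂_⌋)
open import Data.Nat.Logarithm.Core using (⌊log2⌋)
open import Data.Nat.Induction using (<-wellFounded)
open import Data.Nat.Tactic.RingSolver using (solve-∀)
open import Induction.WellFounded using (Acc; acc)
open import Data.Bool using (true; false; if_then_else_)
open import Data.List using ([]; _∷_; allFin; filter; foldl)
open import Data.List.Membership.Propositional using (_∈_; find; lose)
open import Data.List.Membership.Propositional.Properties
  using (∈-concatMap⁺; ∈-concatMap⁻; ∈-map⁺; ∈-map⁻; ∈-filter⁺; ∈-filter⁻; ∈-allFin)
open import Data.List.Relation.Unary.Any using (here; there)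
open import Data.Product using (Σ; ∃-syntax; _×_; _,_; proj₁; proj₂; uncurry)
import Data.Product as Product
open import Data.Sum using (_⊎_; inj₁; inj₂; fromInj₁; [_,_]′)
import Data.Sum as Sum
open import Data.Empty using (⊥-elim)
open import Relation.Binary using (tri<; tri≈; tri>)
open import Relation.Nullary using (¬_; yes; no)
open import Relation.Unary using (Decidable)
open import Relation.Nullary.Decidable using (_×-dec_)
open import Relation.Nullary.Reflects using (ofʸ; ofⁿ)
open import Relation.Binary.PropositionalEquality
  using (_≡_; refl; sym; trans; cong; cong₂; subst; subst₂; module ≡-Reasoning)

module _ {a} {A : Set a} (f : A → ℕ) where

  minStep : A → A → A
  minStep best x = if f x <ᵇ f best then x else best

  minStep-∈ : ∀ b x → minStep b x ≡ b ⊎ minStep b x ≡ x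
  minStep-∈ b x with f x <ᵇ f b
  ... | true  = inj₂ refl
  ... | false = inj₁ refl

  minStep-≤ˡ : ∀ b x → f (minStep b x) ≤ f b
  minStep-≤ˡ b x with f x <ᵇ f b | <ᵇ-reflects-< (f x) (f b)
  ... | true  | ofʸ x<b = <⇒≤ x<b
  ... | false | ofⁿ _   = ≤-refl

  minStep-≤ʳ : ∀ b x → f (minStep b x) ≤ f x
  minStep-≤ʳ b x with f x <ᵇ f b | <ᵇ-reflects-< (f x) (f b)
  ... | true  | ofʸ _   = ≤-refl
  ... | false | ofⁿ x≮b = ≮⇒≥ x≮b

  foldl-minStep-∈ : ∀ b xs → foldl minStep b xs ∈ b ∷ xs
  foldl-minStep-∈ b []       = here refl
  foldl-minStep-∈ b (x ∷ xs) with foldl-minStep-∈ (minStep b x) xs | minStep-∈ b x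
  ... | here r≡step | inj₁ step≡b = here (trans r≡step step≡b)
  ... | here r≡step | inj₂ step≡x = there (here (trans r≡step step≡x))
  ... | there r∈xs  | _           = there (there r∈xs)

  foldl-minStep-≤ : ∀ b xs {y} → y ∈ b ∷ xs → f (foldl minStep b xs) ≤ f y
  foldl-minStep-≤ b []       (here refl) = ≤-refl
  foldl-minStep-≤ b (x ∷ xs) (here refl) =
    ≤-trans (foldl-minStep-≤ (minStep b x) xs (here refl)) (minStep-≤ˡ b x)
  foldl-minStep-≤ b (x ∷ xs) (there (here refl)) =
    ≤-trans (foldl-minStep-≤ (minStep b x) xs (here refl)) (minStep-≤ʳ b x)
  foldl-minStep-≤ b (x ∷ xs) (there (there y∈xs)) = foldl-minStep-≤ (minStep b x) xs (there y∈xs)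

infix 4 _∈[_,_] _∈ᵇ_

_∈[_,_] : ℕ → ℕ → ℕ → Set
a ∈[ l , u ] = l ≤ a × a ≤ u

∈[]⇒≤ : ∀ {a l u} → a ∈[ l , u ] → l ≤ u
∈[]⇒≤ (l≤a , a≤u) = ≤-trans l≤a a≤u

record Box : Set where
  constructor box
  field
    top bottom left right : ℕ

_∈ᵇ_ : ℕ × ℕ → Box → Set
(a , b) ∈ᵇ box t u l r = a ∈[ t , u ] × b ∈[ l , r ]

StrictMinIn : (ℕ → ℕ → ℕ) → Box → ℕ × ℕ → Set
StrictMinIn V B p = p ∈ᵇ B × (∀ q → q ∈ᵇ B → q ≡ p ⊎ uncurry V p < uncurry V q)

HasEntries : ∀ {m n σ} → Array m n σ → (ℕ → ℕ → ℕ) → Set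
HasEntries A V = ∀ i j → toℕ (A i j) ≡ V (toℕ i) (toℕ j)

coords : ∀ {m n} → Pos m n → ℕ × ℕ
coords = Product.map toℕ toℕ

queryBox : ∀ {m n} → Fin m → Fin m → Fin n → Fin n → Box
queryBox i₁ i₂ j₁ j₂ = box (toℕ i₁) (toℕ i₂) (toℕ j₁) (toℕ j₂)

module _ {m n : ℕ} {i₁ i₂ : Fin m} {j₁ j₂ : Fin n} where

  private
    inRows : Decidable (λ (i : Fin m) → i₁ ≤ᶠ i × i ≤ᶠ i₂)
    inRows i = (i₁ ≤ᶠ? i) ×-dec (i ≤ᶠ? i₂)

    inCols : Decidable (λ (j : Fin n) → j₁ ≤ᶠ j × j ≤ᶠ j₂)
    inCols j = (j₁ ≤ᶠ? j) ×-dec (j ≤ᶠ? j₂)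

  ∈-rect⁺ : ∀ q → coords q ∈ᵇ queryBox i₁ i₂ j₁ j₂ → q ∈ rect i₁ i₂ j₁ j₂
  ∈-rect⁺ (i , j) (i∈ , j∈) =
    ∈-concatMap⁺ _ (lose (∈-filter⁺ inRows (∈-allFin i) i∈)
                         (∈-map⁺ (i ,_) (∈-filter⁺ inCols (∈-allFin j) j∈)))

  ∈-rect⁻ : ∀ q → q ∈ rect i₁ i₂ j₁ j₂ → coords q ∈ᵇ queryBox i₁ i₂ j₁ j₂
  ∈-rect⁻ q q∈
    with i , i∈ , q∈row ← find (∈-concatMap⁻ _ {xs = filter inRows (allFin m)} q∈)
    with j , j∈ , refl ← ∈-map⁻ (i ,_) q∈row
    = proj₂ (∈-filter⁻ inRows {xs = allFin m} i∈) , proj₂ (∈-filter⁻ inCols {xs = allFin n} j∈)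

rmq-strictMin : ∀ {m n σ} (A : Array m n σ) {V : ℕ → ℕ → ℕ} → HasEntries A V →
  ∀ i₁ i₂ j₁ j₂ {p} → StrictMinIn V (queryBox i₁ i₂ j₁ j₂) p →
  coords (rmq A i₁ i₂ j₁ j₂) ≡ p
rmq-strictMin {m} {n} A {V} A≡V i₁ i₂ j₁ j₂ {p@(a , b)} (p∈@(a∈ , b∈) , below) =
  fromInj₁ (λ p<r → ⊥-elim (<⇒≱ p<r r≤p)) (below (coords r) r∈box)
  where
    value : Pos m n → ℕ
    value q = toℕ (A (proj₁ q) (proj₂ q))

    r : Pos m n
    r = rmq A i₁ i₂ j₁ j₂

    r∈box : coords r ∈ᵇ queryBox i₁ i₂ j₁ j₂
    r∈box with foldl-minStep-∈ value (i₁ , j₁) (rect i₁ i₂ j₁ j₂)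
    ... | here r≡corner rewrite r≡corner = (≤-refl , ∈[]⇒≤ a∈) , (≤-refl , ∈[]⇒≤ b∈)
    ... | there r∈rect = ∈-rect⁻ r r∈rect

    p̂ : Pos m n
    p̂ = fromℕ< (≤-<-trans (proj₂ a∈) (toℕ<n i₂)) , fromℕ< (≤-<-trans (proj₂ b∈) (toℕ<n j₂))

    coords-p̂ : coords p̂ ≡ p
    coords-p̂ = cong₂ _,_ (toℕ-fromℕ< _) (toℕ-fromℕ< _)

    r≤p : uncurry V (coords r) ≤ uncurry V p
    r≤p = begin
      uncurry V (coords r)  ≡⟨ sym (A≡V (proj₁ r) (proj₂ r)) ⟩
      value r               ≤⟨ foldl-minStep-≤ value (i₁ , j₁) (rect i₁ i₂ j₁ j₂)
                                                 (there (∈-rect⁺ p̂ p̂∈box)) ⟩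
      value p̂               ≡⟨ A≡V (proj₁ p̂) (proj₂ p̂) ⟩
      uncurry V (coords p̂)  ≡⟨ cong (uncurry V) coords-p̂ ⟩
      uncurry V p           ∎
      where
        open ≤-Reasoning
        p̂∈box : coords p̂ ∈ᵇ queryBox i₁ i₂ j₁ j₂
        p̂∈box = subst (_∈ᵇ queryBox i₁ i₂ j₁ j₂) (sym coords-p̂) p∈

sameAnswers-strictMin : ∀ {m n σ} {A A′ : Array m n σ} {V V′ : ℕ → ℕ → ℕ} →
  HasEntries A V → HasEntries A′ V′ → SameAnswers A A′ →
  ∀ {B p p′} → Box.bottom B < m → Box.right B < n →
  StrictMinIn V B p → StrictMinIn V′ B p′ → p ≡ p′
sameAnswers-strictMin {m} {n} {A = A} {A′} A≡V A′≡V′ same {B@(box t u l r)} {p} {p′}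
                      u<m r<n min min′ = begin
    p                           ≡⟨ rmq-strictMin A A≡V i₁ i₂ j₁ j₂ (atCorners min) ⟨
    coords (rmq A i₁ i₂ j₁ j₂)  ≡⟨ cong coords (same i₁ i₂ j₁ j₂ i₁≤i₂ j₁≤j₂) ⟩
    coords (rmq A′ i₁ i₂ j₁ j₂) ≡⟨ rmq-strictMin A′ A′≡V′ i₁ i₂ j₁ j₂ (atCorners min′) ⟩
    p′                          ∎
  where
    open ≡-Reasoning
    t<m : t < m
    t<m = ≤-<-trans (∈[]⇒≤ (proj₁ (proj₁ min))) u<m
    l<n : l < n
    l<n = ≤-<-trans (∈[]⇒≤ (proj₂ (proj₁ min))) r<n

    i₁ i₂ : Fin m
    i₁ = fromℕ< t<m
    i₂ = fromℕ< u<m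
    j₁ j₂ : Fin n
    j₁ = fromℕ< l<n
    j₂ = fromℕ< r<n

    box≡ : queryBox i₁ i₂ j₁ j₂ ≡ B
    box≡ rewrite toℕ-fromℕ< t<m | toℕ-fromℕ< u<m | toℕ-fromℕ< l<n | toℕ-fromℕ< r<n = refl

    atCorners : ∀ {W q} → StrictMinIn W B q → StrictMinIn W (queryBox i₁ i₂ j₁ j₂) q
    atCorners = subst (λ B → StrictMinIn _ B _) (sym box≡)

    i₁≤i₂ : toℕ i₁ ≤ toℕ i₂
    i₁≤i₂ = ∈[]⇒≤ (proj₁ (proj₁ (atCorners min)))
    j₁≤j₂ : toℕ j₁ ≤ toℕ j₂
    j₁≤j₂ = ∈[]⇒≤ (proj₂ (proj₁ (atCorners min)))

translate : ℕ → ℕ → Box → Box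
translate o₁ o₂ (box t u l r) = box (o₁ + t) (o₁ + u) (o₂ + l) (o₂ + r)

∈[]-translate⁺ : ∀ o {a l u} → a ∈[ l , u ] → o + a ∈[ o + l , o + u ]
∈[]-translate⁺ o (l≤a , a≤u) = +-monoʳ-≤ o l≤a , +-monoʳ-≤ o a≤u

∈[]-translate⁻ : ∀ o {a l u} → a ∈[ o + l , o + u ] → ∃[ α ] a ≡ o + α × α ∈[ l , u ]
∈[]-translate⁻ o {a} {l} (o+l≤a , a≤o+u) =
  a ∸ o , a≡ , +-cancelˡ-≤ o l (a ∸ o) (subst (o + l ≤_) a≡ o+l≤a) , m≤n+o⇒m∸n≤o a o a≤o+u
  where
    a≡ : a ≡ o + (a ∸ o)
    a≡ = sym (m+[n∸m]≡n (≤-trans (m≤m+n o l) o+l≤a))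

StrictMinIn-translate : ∀ {V W : ℕ → ℕ → ℕ} o₁ o₂ {B a b} →
  (∀ α β → (α , β) ∈ᵇ B → V (o₁ + α) (o₂ + β) ≡ W α β) →
  StrictMinIn W B (a , b) → StrictMinIn V (translate o₁ o₂ B) (o₁ + a , o₂ + b)
StrictMinIn-translate {V} o₁ o₂ {B} {a} {b} V≡W ((a∈ , b∈) , below) =
  (∈[]-translate⁺ o₁ a∈ , ∈[]-translate⁺ o₂ b∈) , below′
  where
    below′ : ∀ q → q ∈ᵇ translate o₁ o₂ B →
      q ≡ (o₁ + a , o₂ + b) ⊎ V (o₁ + a) (o₂ + b) < uncurry V q
    below′ (a′ , b′) (a′∈ , b′∈)
      with α , refl , α∈ ← ∈[]-translate⁻ o₁ a′∈
      with β , refl , β∈ ← ∈[]-translate⁻ o₂ b′∈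
      with below (α , β) (α∈ , β∈)
    ... | inj₁ refl = inj₁ refl
    ... | inj₂ Wab<Wαβ =
      inj₂ (subst₂ _<_ (sym (V≡W a b (a∈ , b∈))) (sym (V≡W α β (α∈ , β∈))) Wab<Wαβ)

radix-< : ∀ {t k x α} β → x < t → k < α → k * t + x < α * t + β
radix-< {t} {k} {x} {α} β x<t k<α = begin-strict
  k * t + x   <⟨ +-monoʳ-< (k * t) x<t ⟩
  k * t + t   ≡⟨ +-comm (k * t) t ⟩
  suc k * t   ≤⟨ *-monoˡ-≤ t k<α ⟩
  α * t       ≤⟨ m≤m+n (α * t) β ⟩
  α * t + β   ∎
  where open ≤-Reasoning

m<n⇒1+2m<2n : ∀ {m n} → m < n → suc (2 * m) < 2 * n
m<n⇒1+2m<2n {m} {n} m<n = subst (_≤ 2 * n) (*-suc 2 m) (*-monoʳ-≤ 2 m<n)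

module Block (d τ σ : ℕ) where

  t R : ℕ
  t = suc τ
  R = suc (2 * d)

  -- Levels decrease towards the bottom right, so in a query rectangle whose bottom-right corner
  -- is a data cell, every other data cell lies on a strictly higher level.
  level : ℕ → ℕ → ℕ
  level i j = 2 * d ∸ (i + j)

  level<R : ∀ i j → level i j < R
  level<R i j = s≤s (m∸n≤m (2 * d) (i + j))

  reference : ℕ → ℕ → ℕ
  reference α β = suc (2 * (α * t + β))

  datum : ℕ → ℕ → ℕ
  datum ℓ y = 2 * (ℓ * t + y)

  block : (ℕ → ℕ → ℕ) → ℕ → ℕ → ℕ
  block Y α β with α <? R | β <? τ
  ... | yes _ | yes _ = reference α β
  ... | no _  | no _  = datum (level (α ∸ R) (β ∸ τ)) (Y (α ∸ R) (β ∸ τ))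
  ... | _     | _     = σ

  block-reference : ∀ Y {α β} → α < R → β < τ → block Y α β ≡ reference α β
  block-reference Y {α} {β} α<R β<τ with α <? R | β <? τ
  ... | yes _  | yes _  = refl
  ... | no α≮R | _      = ⊥-elim (α≮R α<R)
  ... | yes _  | no β≮τ = ⊥-elim (β≮τ β<τ)

  block-data : ∀ Y i j → block Y (R + i) (τ + j) ≡ datum (level i j) (Y i j)
  block-data Y i j with R + i <? R | τ + j <? τ
  ... | yes R+i<R | _         = ⊥-elim (m+n≮m R i R+i<R)
  ... | no _      | yes τ+j<τ = ⊥-elim (m+n≮m τ j τ+j<τ)
  ... | no _      | no _      rewrite m+n∸m≡n R i | m+n∸m≡n τ j = refl

  query : ℕ → ℕ → ℕ → Box
  query i j x = box (level i j) (R + i) x (τ + j)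

  module _ (2[2dt+τ]≤σ : 2 * (2 * d * t + τ) ≤ σ) where

    block≤σ : ∀ Y → (∀ i j → Y i j < t) → ∀ α β → block Y α β ≤ σ
    block≤σ Y Y<t α β with α <? R | β <? τ
    ... | yes α<R | yes β<τ =
      <⇒≤ (<-≤-trans (m<n⇒1+2m<2n (+-mono-≤-< (*-monoˡ-≤ t (s≤s⁻¹ α<R)) β<τ)) 2[2dt+τ]≤σ)
    ... | no _    | no _    =
      ≤-trans (*-monoʳ-≤ 2 (+-mono-≤ ℓt≤2dt (s≤s⁻¹ (Y<t (α ∸ R) (β ∸ τ))))) 2[2dt+τ]≤σ
      where
        ℓt≤2dt : level (α ∸ R) (β ∸ τ) * t ≤ 2 * d * t
        ℓt≤2dt = *-monoˡ-≤ t (m∸n≤m (2 * d) (α ∸ R + (β ∸ τ)))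
    ... | yes _   | no _    = ≤-refl
    ... | no _    | yes _   = ≤-refl

    module _ (Y : ℕ → ℕ → ℕ) {i j x : ℕ} (i≤d : i ≤ d) (j≤d : j ≤ d) (x<τ : x < τ) where

      private
        reference<σ : reference (level i j) x < σ
        reference<σ =
          <-≤-trans (m<n⇒1+2m<2n (+-mono-≤-< (*-monoˡ-≤ t (m∸n≤m (2 * d) (i + j))) x<τ)) 2[2dt+τ]≤σ

        i+j≤2d : i + j ≤ 2 * d
        i+j≤2d = subst (i + j ≤_) (cong (d +_) (sym (+-identityʳ d))) (+-mono-≤ i≤d j≤d)

        reference<higherDatum : ∀ {i′ j′} → i′ + j′ < i + j →
          reference (level i j) x < datum (level i′ j′) (Y i′ j′)
        reference<higherDatum i′+j′<i+j =
          m<n⇒1+2m<2n (radix-< _ (m<n⇒m<1+n x<τ) (∸-monoʳ-< i′+j′<i+j i+j≤2d))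

        data-dichotomy : ∀ {i′ j′} → i′ ≤ i → j′ ≤ j →
          (i′ , j′) ≡ (i , j) ⊎ reference (level i j) x < datum (level i′ j′) (Y i′ j′)
        data-dichotomy {i′} {j′} i′≤i j′≤j with m≤n⇒m<n∨m≡n i′≤i | m≤n⇒m<n∨m≡n j′≤j
        ... | inj₂ refl | inj₂ refl = inj₁ refl
        ... | inj₁ i′<i | _         = inj₂ (reference<higherDatum {i′} {j′} (+-mono-<-≤ i′<i j′≤j))
        ... | inj₂ refl | inj₁ j′<j = inj₂ (reference<higherDatum {i′} {j′} (+-monoʳ-< i j′<j))

      query-trichotomy : ∀ {α β} → (α , β) ∈ᵇ query i j x →
        (α , β) ≡ (R + i , τ + j) ⊎ (α , β) ≡ (level i j , x) ⊎ reference (level i j) x < block Y α β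
      query-trichotomy {α} {β} ((k≤α , _) , (x≤β , _)) with α <? R | β <? τ
      ... | yes _ | yes β<τ with m≤n⇒m<n∨m≡n k≤α
      ...   | inj₁ k<α  = inj₂ (inj₂ (s<s (*-monoʳ-< 2 (radix-< β (m<n⇒m<1+n x<τ) k<α))))
      ...   | inj₂ refl with m≤n⇒m<n∨m≡n x≤β
      ...     | inj₁ x<β  = inj₂ (inj₂ (s<s (*-monoʳ-< 2 (+-monoʳ-< (level i j * t) x<β))))
      ...     | inj₂ refl = inj₂ (inj₁ refl)
      query-trichotomy _ | yes _ | no _  = inj₂ (inj₂ reference<σ)
      query-trichotomy _ | no _  | yes _ = inj₂ (inj₂ reference<σ)
      query-trichotomy {α} {β} ((_ , α≤R+i) , (_ , β≤τ+j)) | no α≮R | no β≮τ =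
        Sum.map (λ eq → cong₂ _,_ (offset≡ α≮R (cong proj₁ eq)) (offset≡ β≮τ (cong proj₂ eq))) inj₂
                (data-dichotomy (m≤n+o⇒m∸n≤o α R α≤R+i) (m≤n+o⇒m∸n≤o β τ β≤τ+j))
        where
          offset≡ : ∀ {o a b} → ¬ a < o → a ∸ o ≡ b → a ≡ o + b
          offset≡ a≮o refl = sym (m+[n∸m]≡n (≮⇒≥ a≮o))

      private
        block-reference-query : block Y (level i j) x ≡ reference (level i j) x
        block-reference-query = block-reference Y (level<R i j) x<τ

        level≤R+i : level i j ≤ R + i
        level≤R+i = ≤-trans (<⇒≤ (level<R i j)) (m≤m+n R i)

        x≤τ+j : x ≤ τ + j
        x≤τ+j = ≤-trans (<⇒≤ x<τ) (m≤m+n τ j)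

      block-strictMin-data : Y i j ≡ x → StrictMinIn (block Y) (query i j x) (R + i , τ + j)
      block-strictMin-data refl = ((level≤R+i , ≤-refl) , (x≤τ+j , ≤-refl)) , below
        where
          data<reference : block Y (R + i) (τ + j) < reference (level i j) x
          data<reference = ≤-reflexive (cong suc (block-data Y i j))

          below : ∀ q → q ∈ᵇ query i j x →
            q ≡ (R + i , τ + j) ⊎ block Y (R + i) (τ + j) < uncurry (block Y) q
          below (α , β) q∈ with query-trichotomy q∈
          ... | inj₁ q≡data        = inj₁ q≡data
          ... | inj₂ (inj₁ refl)   =
            inj₂ (subst (block Y (R + i) (τ + j) <_) (sym block-reference-query) data<reference)
          ... | inj₂ (inj₂ ref<q)  = inj₂ (<-trans data<reference ref<q)

      block-strictMin-reference : x < Y i j → StrictMinIn (block Y) (query i j x) (level i j , x)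
      block-strictMin-reference x<Y = ((≤-refl , level≤R+i) , (≤-refl , x≤τ+j)) , below
        where
          below : ∀ q → q ∈ᵇ query i j x →
            q ≡ (level i j , x) ⊎ block Y (level i j) x < uncurry (block Y) q
          below (α , β) q∈ with query-trichotomy q∈
          ... | inj₁ refl          = inj₂ (subst₂ _<_ (sym block-reference-query) (sym (block-data Y i j))
                                          (m<n⇒1+2m<2n (+-monoʳ-< (level i j * t) x<Y)))
          ... | inj₂ (inj₁ q≡ref)  = inj₁ q≡ref
          ... | inj₂ (inj₂ ref<q)  =
            inj₂ (subst (_< uncurry (block Y) (α , β)) (sym block-reference-query) ref<q)

module _ (b : ℕ) .{{_ : NonZero b}} where

  digit : ℕ → ℕ → ℕ
  digit c zero    = c % b
  digit c (suc k) = digit (c / b) k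

  digit< : ∀ c k → digit c k < b
  digit< c zero    = m%n<n c b
  digit< c (suc k) = digit< (c / b) k

  digit-injective : ∀ N {c c′} → c < b ^ N → c′ < b ^ N →
    (∀ (k : Fin N) → digit c (toℕ k) ≡ digit c′ (toℕ k)) → c ≡ c′
  digit-injective zero    c<1 c′<1 _ = trans (n<1⇒n≡0 c<1) (sym (n<1⇒n≡0 c′<1))
  digit-injective (suc N) {c} {c′} c<bᴺ⁺¹ c′<bᴺ⁺¹ digits≡ = begin
    c                    ≡⟨ m≡m%n+[m/n]*n c b ⟩
    c % b + c / b * b    ≡⟨ cong₂ (λ r q → r + q * b) (digits≡ Fin.zero) quotients≡ ⟩
    c′ % b + c′ / b * b  ≡⟨ m≡m%n+[m/n]*n c′ b ⟨
    c′                   ∎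
    where
      open ≡-Reasoning
      quotient< : ∀ {a} → a < b ^ suc N → a / b < b ^ N
      quotient< {a} a<bᴺ⁺¹ = m<n*o⇒m/o<n (subst (a <_) (*-comm b (b ^ N)) a<bᴺ⁺¹)

      quotients≡ : c / b ≡ c′ / b
      quotients≡ =
        digit-injective N (quotient< c<bᴺ⁺¹) (quotient< c′<bᴺ⁺¹) (λ k → digits≡ (Fin.suc k))

[m*n+o]/n≡m : ∀ m {n o} .{{_ : NonZero n}} → o < n → (m * n + o) / n ≡ m
[m*n+o]/n≡m m {n} {o} o<n = begin
  (m * n + o) / n    ≡⟨ +-distrib-/-∣ˡ o (n∣m*n m) ⟩
  m * n / n + o / n  ≡⟨ cong₂ _+_ (m*n/n≡m m n) (m<n⇒m/n≡0 o<n) ⟩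
  m + 0              ≡⟨ +-identityʳ m ⟩
  m                  ∎
  where open ≡-Reasoning

[m*n+o]%n≡o : ∀ m {n o} .{{_ : NonZero n}} → o < n → (m * n + o) % n ≡ o
[m*n+o]%n≡o m o<n = trans (%-remove-+ˡ _ (n∣m*n m)) (m<n⇒m%n≡m o<n)

tile-< : ∀ {m n i o} .{{_ : NonZero n}} → i < m / n → o < n → i * n + o < m
tile-< {m} {n} {i} {o} i<m/n o<n = begin-strict
  i * n + o    <⟨ +-monoʳ-< (i * n) o<n ⟩
  i * n + n    ≡⟨ +-comm (i * n) n ⟩
  suc i * n    ≤⟨ *-monoˡ-≤ n i<m/n ⟩
  m / n * n    ≤⟨ m/n*n≤m m n ⟩
  m            ∎
  where open ≤-Reasoning

SameAnswers-sym : ∀ {m n σ} {A A′ : Array m n σ} → SameAnswers A A′ → SameAnswers A′ A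
SameAnswers-sym same i₁ i₂ j₁ j₂ i₁≤i₂ j₁≤j₂ = sym (same i₁ i₂ j₁ j₂ i₁≤i₂ j₁≤j₂)

module Tiling (m n σ d τ : ℕ) (2[2dt+τ]≤σ : 2 * (2 * d * suc τ + τ) ≤ σ) where

  open Block d τ σ

  S P Q B₁ B₂ N : ℕ
  S  = suc d
  P  = R + S
  Q  = suc (τ + d)
  B₁ = m / P
  B₂ = n / Q
  N  = B₁ * B₂ * S * S

  cellIndex : ℕ → ℕ → ℕ → ℕ → ℕ
  cellIndex bi bj i j = S * (S * (B₂ * bi + bj) + i) + j

  cell : ℕ → ℕ → ℕ → ℕ → ℕ → ℕ
  cell c bi bj i j = digit t c (cellIndex bi bj i j)

  entry : ℕ → ℕ → ℕ → ℕ
  entry c a b = block (cell c (a / P) (b / Q)) (a % P) (b % Q)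

  entry-tile : ∀ c {bi bj α β} → α < P → β < Q →
    entry c (bi * P + α) (bj * Q + β) ≡ block (cell c bi bj) α β
  entry-tile c {bi} {bj} α<P β<Q
    rewrite [m*n+o]/n≡m bi α<P | [m*n+o]%n≡o bi α<P | [m*n+o]/n≡m bj β<Q | [m*n+o]%n≡o bj β<Q = refl

  entry≤σ : ∀ c a b → entry c a b ≤ σ
  entry≤σ c a b =
    block≤σ 2[2dt+τ]≤σ (cell c (a / P) (b / Q)) (λ i j → digit< t c (cellIndex (a / P) (b / Q) i j))
            (a % P) (b % Q)

  array : ℕ → Array m n σ
  array c a b = fromℕ< (s≤s (entry≤σ c (toℕ a) (toℕ b)))

  array-entries : ∀ c → HasEntries (array c) (entry c)
  array-entries c a b = toℕ-fromℕ< _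

  separating : ∀ {c c′ bi bj i j} → bi < B₁ → bj < B₂ → i ≤ d → j ≤ d →
    cell c bi bj i j < cell c′ bi bj i j → ¬ SameAnswers (array c) (array c′)
  separating {c} {c′} {bi} {bj} {i} {j} bi<B₁ bj<B₂ i≤d j≤d x<x′ same =
    <⇒≱ (level<R i j) (≤-trans (m≤m+n R i) (≤-reflexive R+i≡level))
    where
      x : ℕ
      x = cell c bi bj i j

      x<τ : x < τ
      x<τ = <-≤-trans x<x′ (s≤s⁻¹ (digit< t c′ (cellIndex bi bj i j)))

      R+i<P : R + i < P
      R+i<P = +-monoʳ-< R (s≤s i≤d)

      τ+j<Q : τ + j < Q
      τ+j<Q = s≤s (+-monoʳ-≤ τ j≤d)

      inTile : ∀ c₀ α β → (α , β) ∈ᵇ query i j x →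
        entry c₀ (bi * P + α) (bj * Q + β) ≡ block (cell c₀ bi bj) α β
      inTile c₀ α β ((_ , α≤R+i) , (_ , β≤τ+j)) =
        entry-tile c₀ (≤-<-trans α≤R+i R+i<P) (≤-<-trans β≤τ+j τ+j<Q)

      minima≡ : (bi * P + (R + i) , bj * Q + (τ + j)) ≡ (bi * P + level i j , bj * Q + x)
      minima≡ = sameAnswers-strictMin {V = entry c} {entry c′} (array-entries c) (array-entries c′) same
        {translate (bi * P) (bj * Q) (query i j x)} (tile-< bi<B₁ R+i<P) (tile-< bj<B₂ τ+j<Q)
        (StrictMinIn-translate (bi * P) (bj * Q) (inTile c)
          (block-strictMin-data 2[2dt+τ]≤σ (cell c bi bj) i≤d j≤d x<τ refl))
        (StrictMinIn-translate (bi * P) (bj * Q) (inTile c′)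
          (block-strictMin-reference 2[2dt+τ]≤σ (cell c′ bi bj) i≤d j≤d x<τ x<x′))

      R+i≡level : R + i ≡ level i j
      R+i≡level = +-cancelˡ-≡ (bi * P) _ _ (cong proj₁ minima≡)

  cells-agree : ∀ {c c′} → SameAnswers (array c) (array c′) →
    ∀ {bi bj i j} → bi < B₁ → bj < B₂ → i ≤ d → j ≤ d → cell c bi bj i j ≡ cell c′ bi bj i j
  cells-agree {c} {c′} same {bi} {bj} {i} {j} bi<B₁ bj<B₂ i≤d j≤d
    with <-cmp (cell c bi bj i j) (cell c′ bi bj i j)
  ... | tri< x<x′ _ _ = ⊥-elim (separating bi<B₁ bj<B₂ i≤d j≤d x<x′ same)
  ... | tri≈ _ x≡x′ _ = x≡x′
  ... | tri> _ _ x′<x =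
    ⊥-elim (separating bi<B₁ bj<B₂ i≤d j≤d x′<x (SameAnswers-sym {A = array c} {array c′} same))

  cellIndex-surjective : ∀ (k : Fin N) → ∃[ bi ] ∃[ bj ] ∃[ i ] ∃[ j ]
    bi < B₁ × bj < B₂ × i ≤ d × j ≤ d × toℕ k ≡ cellIndex bi bj i j
  cellIndex-surjective k
    with u , j , refl ← combine-surjective {B₁ * B₂ * S} {S} k
    with v , i , refl ← combine-surjective {B₁ * B₂} {S} u
    with bi , bj , refl ← combine-surjective {B₁} {B₂} v
    = toℕ bi , toℕ bj , toℕ i , toℕ j
    , toℕ<n bi , toℕ<n bj , s≤s⁻¹ (toℕ<n i) , s≤s⁻¹ (toℕ<n j)
    , (begin
        toℕ (combine (combine (combine bi bj) i) j)
          ≡⟨ toℕ-combine (combine (combine bi bj) i) j ⟩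
        S * toℕ (combine (combine bi bj) i) + toℕ j
          ≡⟨ cong (λ u → S * u + toℕ j) (toℕ-combine (combine bi bj) i) ⟩
        S * (S * toℕ (combine bi bj) + toℕ i) + toℕ j
          ≡⟨ cong (λ v → S * (S * v + toℕ i) + toℕ j) (toℕ-combine bi bj) ⟩
        cellIndex (toℕ bi) (toℕ bj) (toℕ i) (toℕ j)
          ∎)
    where open ≡-Reasoning

  family : DistinctFamily m n σ
  family = record { K = t ^ N ; arrays = λ c → array (toℕ c) ; distinct = distinct }
    where
      distinct : ∀ c c′ → SameAnswers (array (toℕ c)) (array (toℕ c′)) → c ≡ c′
      distinct c c′ same = toℕ-injective (digit-injective t N (toℕ<n c) (toℕ<n c′) digits≡)
        where
          digits≡ : ∀ (k : Fin N) → digit t (toℕ c) (toℕ k) ≡ digit t (toℕ c′) (toℕ k)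
          digits≡ k with _ , _ , _ , _ , bi<B₁ , bj<B₂ , i≤d , j≤d , k≡ ← cellIndex-surjective k
            rewrite k≡ = cells-agree same bi<B₁ bj<B₂ i≤d j≤d

m≤2*[m/n*n] : ∀ {m n} .{{_ : NonZero n}} → n ≤ m → m ≤ 2 * (m / n * n)
m≤2*[m/n*n] {m} {n} n≤m = begin
  m                      ≡⟨ m≡m%n+[m/n]*n m n ⟩
  m % n + m / n * n      ≤⟨ +-monoˡ-≤ (m / n * n) (<⇒≤ (m%n<n m n)) ⟩
  n + m / n * n          ≤⟨ +-monoˡ-≤ (m / n * n) n≤m/n*n ⟩
  m / n * n + m / n * n  ≡⟨ cong (m / n * n +_) (+-identityʳ (m / n * n)) ⟨
  2 * (m / n * n)        ∎
  where
    open ≤-Reasoning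
    n≤m/n*n : n ≤ m / n * n
    n≤m/n*n = subst (_≤ m / n * n) (*-identityˡ n) (*-monoˡ-≤ n (m≥n⇒m/n>0 n≤m))

2^[a*l]≤[tᴺ]^[u*v] : ∀ {a l t N} u v → a ≤ u * N → 2 ^ l ≤ t ^ v → 2 ^ (a * l) ≤ (t ^ N) ^ (u * v)
2^[a*l]≤[tᴺ]^[u*v] {a} {l} {t} {N} u v a≤uN 2ˡ≤tᵛ = begin
  2 ^ (a * l)         ≤⟨ ^-monoʳ-≤ 2 (*-monoˡ-≤ l a≤uN) ⟩
  2 ^ (u * N * l)     ≡⟨ cong (2 ^_) (*-comm (u * N) l) ⟩
  2 ^ (l * (u * N))   ≡⟨ ^-*-assoc 2 l (u * N) ⟨
  (2 ^ l) ^ (u * N)   ≤⟨ ^-monoˡ-≤ (u * N) 2ˡ≤tᵛ ⟩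
  (t ^ v) ^ (u * N)   ≡⟨ ^-*-assoc t v (u * N) ⟩
  t ^ (v * (u * N))   ≡⟨ cong (t ^_) (exponents≡ v u N) ⟩
  t ^ (N * (u * v))   ≡⟨ ^-*-assoc t N (u * v) ⟨
  (t ^ N) ^ (u * v)   ∎
  where
    open ≤-Reasoning
    exponents≡ : ∀ v u N → v * (u * N) ≡ N * (u * v)
    exponents≡ = solve-∀

2*⌊n/2⌋≤n : ∀ n → 2 * ⌊ n /2⌋ ≤ n
2*⌊n/2⌋≤n zero          = z≤n
2*⌊n/2⌋≤n (suc zero)    = z≤n
2*⌊n/2⌋≤n (suc (suc n)) = subst (_≤ 2 + n) (sym (*-suc 2 ⌊ n /2⌋)) (+-monoʳ-≤ 2 (2*⌊n/2⌋≤n n))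

2^⌊log2⌋[1+n]≤1+n : ∀ n (rec : Acc _<_ (suc n)) → 2 ^ ⌊log2⌋ (suc n) rec ≤ suc n
2^⌊log2⌋[1+n]≤1+n zero    _         = ≤-refl
2^⌊log2⌋[1+n]≤1+n (suc n) (acc rs)  = begin
  2 * 2 ^ ⌊log2⌋ (suc ⌊ n /2⌋) _  ≤⟨ *-monoʳ-≤ 2 (2^⌊log2⌋[1+n]≤1+n ⌊ n /2⌋ _) ⟩
  2 * suc ⌊ n /2⌋                 ≡⟨ *-suc 2 ⌊ n /2⌋ ⟩
  2 + 2 * ⌊ n /2⌋                 ≤⟨ +-monoʳ-≤ 2 (2*⌊n/2⌋≤n n) ⟩
  2 + n                           ∎
  where open ≤-Reasoning

2^⌊log₂[1+n]⌋≤1+n : ∀ n → 2 ^ ⌊log₂ suc n ⌋ ≤ suc n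
2^⌊log₂[1+n]⌋≤1+n n = 2^⌊log2⌋[1+n]≤1+n n (<-wellFounded (suc n))

m*m≤n*n⇒m≤n : ∀ {m n} → m * m ≤ n * n → m ≤ n
m*m≤n*n⇒m≤n m*m≤n*n = ≮⇒≥ (λ n<m → <⇒≱ (*-mono-< n<m n<m) m*m≤n*n)

m*m<n*n⇒m<n : ∀ {m n} → m * m < n * n → m < n
m*m<n*n⇒m<n m*m<n*n = ≰⇒> (λ n≤m → <⇒≱ m*m<n*n (*-mono-≤ n≤m n≤m))

exponent-split : ∀ {L} → 6 ≤ L → ∃[ h ] 4 + (h + h) ≤ L × L ≤ 7 * h
exponent-split 6≤L with k , refl ← m≤n⇒∃[o]m+o≡n 6≤L = split k
  where
    split : ∀ k → ∃[ h ] 4 + (h + h) ≤ 6 + k × 6 + k ≤ 7 * h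
    split zero          = 1 , ≤-refl , n≤1+n 6
    split (suc zero)    = 1 , n≤1+n 6 , ≤-refl
    split (suc (suc k)) with h , lower , upper ← split k =
      suc h , subst (λ e → 4 + e ≤ 8 + k) (cong suc (sym (+-suc h h))) (s≤s (s≤s lower))
            , subst (8 + k ≤_) (sym (*-suc 7 h)) (+-mono-≤ (m≤m+n 2 5) upper)

tileSide : ∀ {L} → 6 ≤ L → ∃[ d ] 16 * (suc d * suc d) ≤ 2 ^ L × 2 ^ L ≤ suc (suc d) ^ 7
tileSide {L} 6≤L with h , 4+2h≤L , L≤7h ← exponent-split 6≤L = d , lower , upper
  where
    instance
      2ʰ≢0 : NonZero (2 ^ h)
      2ʰ≢0 = m^n≢0 2 h

    d : ℕ
    d = pred (2 ^ h)

    1+d≡2ʰ : suc d ≡ 2 ^ h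
    1+d≡2ʰ = suc-pred (2 ^ h)

    lower : 16 * (suc d * suc d) ≤ 2 ^ L
    lower = begin
      16 * (suc d * suc d)    ≡⟨ cong (λ s → 16 * (s * s)) 1+d≡2ʰ ⟩
      16 * (2 ^ h * 2 ^ h)    ≡⟨ cong (16 *_) (^-distribˡ-+-* 2 h h) ⟨
      16 * 2 ^ (h + h)        ≡⟨ ^-distribˡ-+-* 2 4 (h + h) ⟨
      2 ^ (4 + (h + h))       ≤⟨ ^-monoʳ-≤ 2 4+2h≤L ⟩
      2 ^ L                   ∎
      where open ≤-Reasoning

    upper : 2 ^ L ≤ suc (suc d) ^ 7
    upper = begin
      2 ^ L            ≤⟨ ^-monoʳ-≤ 2 L≤7h ⟩
      2 ^ (7 * h)      ≡⟨ cong (2 ^_) (*-comm 7 h) ⟩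
      2 ^ (h * 7)      ≡⟨ ^-*-assoc 2 h 7 ⟨
      (2 ^ h) ^ 7      ≡⟨ cong (_^ 7) 1+d≡2ʰ ⟨
      suc d ^ 7        ≤⟨ ^-monoˡ-≤ 7 (n≤1+n (suc d)) ⟩
      suc (suc d) ^ 7  ∎
      where open ≤-Reasoning

3[1+d]≡1+[3d+2] : ∀ d → 3 * suc d ≡ suc (3 * d + 2)
3[1+d]≡1+[3d+2] = solve-∀

tileFits : ∀ {m σ} d → 16 * (suc d * suc d) ≤ σ → σ ≤ m * m →
  2 * (2 * d * suc (suc d) + suc d) ≤ σ × 3 * d + 2 ≤ m
tileFits {m} {σ} d 16S²≤σ σ≤m*m = fits-σ , 3d+2≤m
  where
    slack : ∀ d →
      2 * (2 * d * suc (suc d) + suc d) + (12 * (d * d) + 22 * d + 14) ≡ 16 * (suc d * suc d)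
    slack = solve-∀
    [3S]²≡9S² : ∀ s → 3 * s * (3 * s) ≡ 9 * (s * s)
    [3S]²≡9S² = solve-∀

    fits-σ : 2 * (2 * d * suc (suc d) + suc d) ≤ σ
    fits-σ = ≤-trans (subst (2 * (2 * d * suc (suc d) + suc d) ≤_) (slack d)
                         (m≤m+n (2 * (2 * d * suc (suc d) + suc d)) (12 * (d * d) + 22 * d + 14))) 16S²≤σ

    3S≤m : 3 * suc d ≤ m
    3S≤m = m*m≤n*n⇒m≤n (begin
      3 * suc d * (3 * suc d)  ≡⟨ [3S]²≡9S² (suc d) ⟩
      9 * (suc d * suc d)      ≤⟨ *-monoˡ-≤ (suc d * suc d) (m≤m+n 9 7) ⟩
      16 * (suc d * suc d)     ≤⟨ 16S²≤σ ⟩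
      σ                        ≤⟨ σ≤m*m ⟩
      m * m                    ∎)
      where open ≤-Reasoning

    3d+2≤m : 3 * d + 2 ≤ m
    3d+2≤m = ≤-trans (n≤1+n (3 * d + 2)) (subst (_≤ m) (3[1+d]≡1+[3d+2] d) 3S≤m)

-- 168 = 24 · 7: at least mn/24 data cells, each holding a digit in base d + 2 ≥ 2^(L/7).
LowerBound : ℕ → ℕ → ℕ → ℕ → Set
LowerBound m n σ L = Σ (DistinctFamily m n σ) λ F → 2 ^ (m * n * L) ≤ DistinctFamily.K F ^ 168

trivialFamily : ∀ {m n σ} → LowerBound m n σ 0
trivialFamily {m} {n} =
  record { K = 1 ; arrays = λ _ _ _ → Fin.zero ; distinct = λ { Fin.zero Fin.zero _ → refl } } ,
  ≤-reflexive (cong (2 ^_) (*-zeroʳ (m * n)))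

familyBound : ∀ {m n σ L} d → m ≤ n → 2 * (2 * d * suc (suc d) + suc d) ≤ σ → 3 * d + 2 ≤ m →
  2 ^ L ≤ suc (suc d) ^ 7 → LowerBound m n σ L
familyBound {m} {n} {σ} {L} d m≤n fits-σ 3d+2≤m 2ᴸ≤t⁷ =
  family , 2^[a*l]≤[tᴺ]^[u*v] {m * n} {L} {suc (suc d)} {N} 24 7 area 2ᴸ≤t⁷
  where
    open Tiling m n σ d (suc d) fits-σ

    P≡3d+2 : ∀ d → suc (2 * d) + suc d ≡ 3 * d + 2
    P≡3d+2 = solve-∀
    Q≡2S : ∀ d → suc (suc d + d) ≡ 2 * suc d
    Q≡2S = solve-∀
    P≡Q+d : ∀ d → 3 * d + 2 ≡ 2 * suc d + d
    P≡Q+d = solve-∀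
    area≡ : ∀ x y s → 2 * (x * (3 * s)) * (2 * (y * (2 * s))) ≡ 24 * (x * y * s * s)
    area≡ = solve-∀

    P≤m : P ≤ m
    P≤m = subst (_≤ m) (sym (P≡3d+2 d)) 3d+2≤m

    P≤3S : P ≤ 3 * S
    P≤3S = subst₂ _≤_ (sym (P≡3d+2 d)) (sym (3[1+d]≡1+[3d+2] d)) (n≤1+n (3 * d + 2))

    Q≤2S : Q ≤ 2 * S
    Q≤2S = ≤-reflexive (Q≡2S d)

    Q≤n : Q ≤ n
    Q≤n = ≤-trans Q≤2S (≤-trans (subst (2 * S ≤_) (sym (P≡Q+d d)) (m≤m+n (2 * S) d))
                                (≤-trans 3d+2≤m m≤n))

    area : m * n ≤ 24 * N
    area = begin
      m * n                                      ≤⟨ *-mono-≤ (m≤2*[m/n*n] P≤m) (m≤2*[m/n*n] Q≤n) ⟩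
      2 * (B₁ * P) * (2 * (B₂ * Q))              ≤⟨ *-mono-≤ (*-monoʳ-≤ 2 (*-monoʳ-≤ B₁ P≤3S))
                                                             (*-monoʳ-≤ 2 (*-monoʳ-≤ B₂ Q≤2S)) ⟩
      2 * (B₁ * (3 * S)) * (2 * (B₂ * (2 * S)))  ≡⟨ area≡ B₁ B₂ S ⟩
      24 * N                                     ∎
      where open ≤-Reasoning

smallFamily : ∀ {m n σ L} → m ≤ n → σ ≤ m * m → 1 ≤ L → L ≤ 7 → 2 ^ L ≤ σ → LowerBound m n σ L
smallFamily {σ = σ} m≤n σ≤m*m 1≤L L≤7 2ᴸ≤σ =
  familyBound 0 m≤n 2≤σ (m*m<n*n⇒m<n {1} (<-≤-trans 2≤σ σ≤m*m)) (^-monoʳ-≤ 2 L≤7)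
  where
    2≤σ : 2 ≤ σ
    2≤σ = ≤-trans (^-monoʳ-≤ 2 1≤L) 2ᴸ≤σ

largeFamily : ∀ {m n σ L} → m ≤ n → σ ≤ m * m → 6 ≤ L → 2 ^ L ≤ σ → LowerBound m n σ L
largeFamily m≤n σ≤m*m 6≤L 2ᴸ≤σ =
  let d , 16S²≤2ᴸ , 2ᴸ≤[2+d]⁷ = tileSide 6≤L
      fits-σ , 3d+2≤m         = tileFits d (≤-trans 16S²≤2ᴸ 2ᴸ≤σ) σ≤m*m
  in  familyBound d m≤n fits-σ 3d+2≤m 2ᴸ≤[2+d]⁷

familyForExponent : ∀ {m n σ} L → m ≤ n → σ ≤ m * m → 2 ^ L ≤ σ → LowerBound m n σ L
familyForExponent zero      _   _     _    = trivialFamily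
familyForExponent L@(suc _) m≤n σ≤m*m 2ᴸ≤σ =
  [ (λ L≤7 → smallFamily m≤n σ≤m*m (s≤s z≤n) L≤7 2ᴸ≤σ)
  , (λ 7<L → largeFamily m≤n σ≤m*m (≤-trans (m≤m+n 6 2) 7<L) 2ᴸ≤σ)
  ]′ (≤-<-connex L 7)

theorem18 : Σ ℕ λ d → (m n σ : ℕ) → m ≤ n → σ ≤ m * m → 4 * σ ≤ n * n →
    Σ (DistinctFamily m n σ) λ F →
      2 ^ (m * n * ⌊log₂ σ ⌋) ≤ DistinctFamily.K F ^ suc d
theorem18 = 167 , λ where
  m n zero    _   _     _ → trivialFamily
  m n (suc σ) m≤n σ≤m*m _ →
    familyForExponent ⌊log₂ suc σ ⌋ m≤n σ≤m*m (2^⌊log₂[1+n]⌋≤1+n σ)
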